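{- Let $F$ be a finite forest having two cherries $(c,\ell_1,\ell_2)$ and $(c',\ell_1',\ell_2')$ with $c\ne c'$. Then $o(F)=\mathcal{D}$.
   Context: Maker-Maker domination game on a finite simple graph $G$: Alice and Bob alternately claim previously unclaimed vertices, Alice first; the first player whose claimed vertices form a dominating set of $G$ wins; if all vertices are claimed and nobody dominates, it is a draw. $o(G)=\mathcal{A}$ if Alice has a winning strategy and $o(G)=\mathcal{D}$ otherwise. A leaf is a vertex of degree 1. A cherry is a triple $(c,\ell_1,\ell_2)$ where $\ell_1\ne\ell_2$ are leaves both adjacent to the vertex $c$. -}

module Defs where

open import Data.Nat using (ℕ; zero; suc; _+_)
open import Data.Fin using (Fin; zero; suc; inject₁; fromℕ)
open import Data.Bool using (Bool; true; false)
open import Data.List using (List; length; filterᵇ; allFin)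
open import Data.Product using (Σ; ∃; ∃-syntax; _×_; _,_)
open import Data.Sum using (_⊎_)
open import Function.Definitions using (Injective)
open import Relation.Binary.PropositionalEquality using (_≡_; _≢_)
open import Relation.Nullary using (¬_)

record SimpleGraph (n : ℕ) : Set where
  field
    Adj    : Fin n → Fin n → Bool
    sym    : ∀ u v → Adj u v ≡ Adj v u
    irrefl : ∀ v → Adj v v ≡ false

open SimpleGraph public

module _ {n : ℕ} (G : SimpleGraph n) where

  _~_ : Fin n → Fin n → Set
  u ~ v = Adj G u v ≡ true

  degree : Fin n → ℕ
  degree v = length (filterᵇ (Adj G v) (allFin n))

  Leaf : Fin n → Set
  Leaf v = degree v ≡ 1

  -- a cycle of length k+3 : distinct vertices c 0, ..., c (k+2), consecutive
  -- ones adjacent and the last adjacent to the first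
  record Cycle : Set where
    field
      k        : ℕ
      vtx      : Fin (suc (suc (suc k))) → Fin n
      distinct : Injective _≡_ _≡_ vtx
      step     : ∀ (i : Fin (suc (suc k))) → vtx (inject₁ i) ~ vtx (suc i)
      close    : vtx (fromℕ (suc (suc k))) ~ vtx zero

  Forest : Set
  Forest = ¬ Cycle

  Cherry : Fin n → Fin n → Fin n → Set
  Cherry c l₁ l₂ = l₁ ≢ l₂ × Leaf l₁ × Leaf l₂ × (c ~ l₁) × (c ~ l₂)

data Owner : Set where
  free alice bob : Owner

Position : ℕ → Set
Position n = Fin n → Owner

initial : ∀ {n} → Position n
initial _ = free

claim : ∀ {n} → Position n → Fin n → Owner → Position n
claim {n} s v p w with Data.Fin._≟_ w v
... | Relation.Nullary.yes _ = p
... | Relation.Nullary.no  _ = s w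

module _ {n : ℕ} (G : SimpleGraph n) where

  Dominates : Position n → Owner → Set
  Dominates s p = ∀ v → s v ≡ p ⊎ ∃[ u ] (s u ≡ p × _~_ G u v)

  -- Alice has a winning strategy from position s:
  --   AliceWinsA s : Alice to move,   AliceWinsB s : Bob to move.
  -- (Neither player dominates in s itself; this is maintained by the rules:
  -- Alice's move either makes her dominate (she wins) or leads to a Bob-to-move
  -- position; every Bob move must fail to make Bob dominate.  If no vertex is
  -- free the game is a draw, so Alice cannot win.)
  data AliceWinsA (s : Position n) : Set
  data AliceWinsB (s : Position n) : Set

  data AliceWinsA s where
    winNow   : (v : Fin n) → s v ≡ free → Dominates (claim s v alice) alice →
               AliceWinsA s
    moveThen : (v : Fin n) → s v ≡ free → ¬ Dominates (claim s v alice) alice →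
               AliceWinsB (claim s v alice) → AliceWinsA s

  data AliceWinsB s where
    allReplies : (∃[ v ] s v ≡ free) →
                 (∀ v → s v ≡ free → ¬ Dominates (claim s v bob) bob) →
                 (∀ v → s v ≡ free → AliceWinsA (claim s v bob)) →
                 AliceWinsB s

  -- o(G) = A : Alice has a winning strategy from the empty position
  -- (for n ≥ 1 nobody dominates initially; the graph with no vertices has no cherries).
  OutcomeA : Set
  OutcomeA = AliceWinsA initial

  -- o(G) = D : Alice has no winning strategy
  OutcomeD : Set
  OutcomeD = ¬ OutcomeA

{-# OPTIONS --safe #-}
-- Bob plays a pairing strategy: he pairs c with c′ and the two leaves of each
-- cherry with each other, and whenever Alice claims a vertex whose partner is
-- still free he claims that partner.  Then Alice never owns both vertices of a
-- pair.  But a dominating set contains the centre of every cherry or both of its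
-- leaves, so Alice could only dominate by owning both c and c′.
module Submission where

open import Defs hiding (sym; irrefl)
open import Data.Nat using (ℕ)
open import Data.Fin using (Fin; _≟_)
open import Data.Bool using (T; T?)
open import Data.Maybe using (Maybe; just; nothing)
open import Data.Maybe.Properties using (just-injective)
open import Data.List using (List; []; _∷_; length; filterᵇ; allFin)
open import Data.List.Relation.Unary.Any using (here)
open import Data.List.Membership.Propositional using (_∈_)
open import Data.List.Membership.Propositional.Properties using (∈-filter⁺; ∈-allFin)
open import Data.Product using (Σ-syntax; _×_; _,_)
open import Data.Sum using (_⊎_; inj₁; inj₂; [_,_])
open import Data.Empty using (⊥-elim)
open import Relation.Nullary using (¬_; yes; no)
open import Relation.Binary.PropositionalEquality
  using (_≡_; _≢_; refl; sym; trans; subst; ≢-sym)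

length≡1⇒∈-unique : ∀ {A : Set} {xs : List A} {a b : A} →
                    length xs ≡ 1 → a ∈ xs → b ∈ xs → a ≡ b
length≡1⇒∈-unique {xs = _ ∷ []} _ (here refl) (here refl) = refl

module _ {n : ℕ} (G : SimpleGraph n) where

  ~-sym : ∀ {u v} → _~_ G u v → _~_ G v u
  ~-sym {u} {v} u~v = trans (SimpleGraph.sym G v u) u~v

  leaf-neighbour-unique : ∀ {ℓ a b} → Leaf G ℓ → _~_ G ℓ a → _~_ G ℓ b → a ≡ b
  leaf-neighbour-unique {ℓ} {a} {b} leaf ℓ~a ℓ~b =
    length≡1⇒∈-unique leaf (neighbour∈ ℓ~a) (neighbour∈ ℓ~b)
    where
    neighbour∈ : ∀ {x} → _~_ G ℓ x → x ∈ filterᵇ (Adj G ℓ) (allFin n)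
    neighbour∈ {x} ℓ~x = ∈-filter⁺ (λ y → T? (Adj G ℓ y)) (∈-allFin x)
                           (subst T (sym ℓ~x) _)

  leaf-centre-unique : ∀ {ℓ c c′} → Leaf G ℓ → _~_ G c ℓ → _~_ G c′ ℓ → c ≡ c′
  leaf-centre-unique leaf c~ℓ c′~ℓ =
    leaf-neighbour-unique leaf (~-sym c~ℓ) (~-sym c′~ℓ)

  leaves-of-distinct-centres : ∀ {c ℓ c′ ℓ′} → Leaf G ℓ → _~_ G c ℓ → _~_ G c′ ℓ′ →
                               c ≢ c′ → ℓ ≢ ℓ′
  leaves-of-distinct-centres leaf c~ℓ c′~ℓ c≢c′ refl =
    c≢c′ (leaf-centre-unique leaf c~ℓ c′~ℓ)

  cherry-centre-not-leaf : ∀ {c ℓ₁ ℓ₂ ℓ} → Cherry G c ℓ₁ ℓ₂ → Leaf G ℓ → c ≢ ℓ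
  cherry-centre-not-leaf (ℓ₁≢ℓ₂ , _ , _ , c~ℓ₁ , c~ℓ₂) leaf refl =
    ℓ₁≢ℓ₂ (leaf-neighbour-unique leaf c~ℓ₁ c~ℓ₂)

  dominates-leaf : ∀ {s p c ℓ} → Leaf G ℓ → _~_ G c ℓ → Dominates G s p →
                   s ℓ ≡ p ⊎ s c ≡ p
  dominates-leaf {ℓ = ℓ} leaf c~ℓ dom with dom ℓ
  ... | inj₁ sℓ≡p = inj₁ sℓ≡p
  ... | inj₂ (u , su≡p , u~ℓ) rewrite leaf-centre-unique leaf u~ℓ c~ℓ = inj₂ su≡p

  dominates-cherry : ∀ {s p c ℓ₁ ℓ₂} → Cherry G c ℓ₁ ℓ₂ → Dominates G s p →
                     s c ≡ p ⊎ (s ℓ₁ ≡ p × s ℓ₂ ≡ p)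
  dominates-cherry (_ , leaf₁ , leaf₂ , c~ℓ₁ , c~ℓ₂) dom
    with dominates-leaf leaf₁ c~ℓ₁ dom | dominates-leaf leaf₂ c~ℓ₂ dom
  ... | inj₂ sc≡p | _         = inj₁ sc≡p
  ... | inj₁ _    | inj₂ sc≡p = inj₁ sc≡p
  ... | inj₁ sℓ₁  | inj₁ sℓ₂  = inj₂ (sℓ₁ , sℓ₂)

claim-≡ : ∀ {n} (s : Position n) v p → claim s v p v ≡ p
claim-≡ s v p with v ≟ v
... | yes _ = refl
... | no v≢v = ⊥-elim (v≢v refl)

claim-≢ : ∀ {n} (s : Position n) v p w → w ≢ v → claim s v p w ≡ s w
claim-≢ s v p w w≢v with w ≟ v
... | yes w≡v = ⊥-elim (w≢v w≡v)
... | no _ = refl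

claim-cases : ∀ {n} (s : Position n) v p w {q} → claim s v p w ≡ q →
              (w ≡ v × p ≡ q) ⊎ s w ≡ q
claim-cases s v p w eq with w ≟ v
... | yes w≡v = inj₁ (w≡v , eq)
... | no _ = inj₂ eq

claim-keeps : ∀ {n} (s : Position n) v p w {q} → s v ≡ free → s w ≡ q → q ≢ free →
              claim s v p w ≡ q
claim-keeps s v p w sv≡free sw≡q q≢free with w ≟ v
... | yes refl = ⊥-elim (q≢free (trans (sym sw≡q) sv≡free))
... | no _ = sw≡q

record Matching (n : ℕ) : Set where
  field
    partner        : Fin n → Maybe (Fin n)
    partner-sym    : ∀ {x y} → partner x ≡ just y → partner y ≡ just x
    partner-irrefl : ∀ {x y} → partner x ≡ just y → x ≢ y

open Matching

Paired : ∀ {n} → Matching n → Fin n → Fin n → Set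
Paired M x y = partner M x ≡ just y

Unmatched : ∀ {n} → Matching n → Fin n → Set
Unmatched M x = partner M x ≡ nothing

emptyMatching : ∀ {n} → Matching n
emptyMatching = record
  { partner = λ _ → nothing ; partner-sym = λ () ; partner-irrefl = λ () }

module Extend {n : ℕ} (M : Matching n) {a b : Fin n} (a≢b : a ≢ b)
              (a-free : Unmatched M a) (b-free : Unmatched M b) where

  extendedPartner : Fin n → Maybe (Fin n)
  extendedPartner x with x ≟ a | x ≟ b
  ... | yes _ | _     = just b
  ... | no _  | yes _ = just a
  ... | no _  | no _  = partner M x

  extendedPartner-a : extendedPartner a ≡ just b
  extendedPartner-a with a ≟ a
  ... | yes _ = refl
  ... | no a≢a = ⊥-elim (a≢a refl)

  extendedPartner-b : extendedPartner b ≡ just a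
  extendedPartner-b with b ≟ a | b ≟ b
  ... | yes b≡a | _ = ⊥-elim (a≢b (sym b≡a))
  ... | no _ | yes _ = refl
  ... | no _ | no b≢b = ⊥-elim (b≢b refl)

  matched⇒≢ : ∀ {x y z} → partner M x ≡ just y → Unmatched M z → x ≢ z
  matched⇒≢ px≡y pz≡nothing refl with trans (sym px≡y) pz≡nothing
  ... | ()

  extendedPartner-keeps : ∀ {x y} → partner M x ≡ just y → extendedPartner x ≡ just y
  extendedPartner-keeps {x} px≡y with x ≟ a | x ≟ b
  ... | yes x≡a | _ = ⊥-elim (matched⇒≢ px≡y a-free x≡a)
  ... | no _ | yes x≡b = ⊥-elim (matched⇒≢ px≡y b-free x≡b)
  ... | no _ | no _ = px≡y

  extendedPartner-cases : ∀ {x y} → extendedPartner x ≡ just y →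
    (x ≡ a × y ≡ b) ⊎ (x ≡ b × y ≡ a) ⊎ partner M x ≡ just y
  extendedPartner-cases {x} eq with x ≟ a | x ≟ b
  ... | yes x≡a | _ = inj₁ (x≡a , sym (just-injective eq))
  ... | no _ | yes x≡b = inj₂ (inj₁ (x≡b , sym (just-injective eq)))
  ... | no _ | no _ = inj₂ (inj₂ eq)

  extend : Matching n
  extend = record
    { partner        = extendedPartner
    ; partner-sym    = extended-sym
    ; partner-irrefl = extended-irrefl
    }
    where
    extended-sym : ∀ {x y} → extendedPartner x ≡ just y → extendedPartner y ≡ just x
    extended-sym {x} {y} eq with extendedPartner-cases {x} eq
    ... | inj₁ (refl , refl) = extendedPartner-b
    ... | inj₂ (inj₁ (refl , refl)) = extendedPartner-a
    ... | inj₂ (inj₂ px≡y) = extendedPartner-keeps (partner-sym M px≡y)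

    extended-irrefl : ∀ {x y} → extendedPartner x ≡ just y → x ≢ y
    extended-irrefl {x} {y} eq with extendedPartner-cases {x} eq
    ... | inj₁ (refl , refl) = a≢b
    ... | inj₂ (inj₁ (refl , refl)) = ≢-sym a≢b
    ... | inj₂ (inj₂ px≡y) = partner-irrefl M px≡y

  extend-unmatched : ∀ {x} → x ≢ a → x ≢ b → Unmatched M x → Unmatched extend x
  extend-unmatched {x} x≢a x≢b px≡nothing with x ≟ a | x ≟ b
  ... | yes x≡a | _ = ⊥-elim (x≢a x≡a)
  ... | no _ | yes x≡b = ⊥-elim (x≢b x≡b)
  ... | no _ | no _ = px≡nothing

open Extend using (extend; extendedPartner-a; extendedPartner-keeps; extend-unmatched)

module PairingStrategy {n : ℕ} (M : Matching n) where

  _⋈_ : Fin n → Fin n → Set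
  x ⋈ y = Paired M x y

  AliceOwnsNoPair : Position n → Set
  AliceOwnsNoPair s = ∀ {x y} → x ⋈ y → s x ≡ alice → s y ≢ alice

  BobAnswered : Position n → Set
  BobAnswered s = ∀ {x y} → x ⋈ y → s x ≡ alice → s y ≡ bob

  bobAnswered-initial : BobAnswered initial
  bobAnswered-initial _ ()

  module AfterAlice {s v} (answered : BobAnswered s) (sv≡free : s v ≡ free) where

    s₁ = claim s v alice

    earlier-partner-not-alice : ∀ {x y} → x ⋈ y → s x ≡ alice → s₁ y ≢ alice
    earlier-partner-not-alice {x} {y} x⋈y sx≡alice s₁y≡alice
      with answered x⋈y sx≡alice | claim-cases s v alice y s₁y≡alice
    ... | sy≡bob | inj₁ (refl , _) with trans (sym sy≡bob) sv≡free
    ...   | ()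
    earlier-partner-not-alice x⋈y sx≡alice s₁y≡alice
        | sy≡bob | inj₂ sy≡alice with trans (sym sy≡bob) sy≡alice
    ...   | ()

    aliceOwnsNoPair-after-alice : AliceOwnsNoPair s₁
    aliceOwnsNoPair-after-alice {x} {y} x⋈y s₁x≡alice
      with claim-cases s v alice x s₁x≡alice
    ... | inj₂ sx≡alice = earlier-partner-not-alice x⋈y sx≡alice
    ... | inj₁ (refl , _) = λ s₁y≡alice →
      [ (λ { (refl , _) → partner-irrefl M x⋈y refl })
      , (λ sy≡alice → earlier-partner-not-alice (partner-sym M x⋈y) sy≡alice s₁x≡alice)
      ] (claim-cases s v alice y s₁y≡alice)

  open AfterAlice using (aliceOwnsNoPair-after-alice)

  bobReply : Position n → (v e : Fin n) → Fin n
  bobReply s v e with partner M v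
  ... | nothing = e
  ... | just y with s y
  ...   | free = y
  ...   | _ = e

  bobReply-free : ∀ (s : Position n) v {e} → s e ≡ free → s (bobReply s v e) ≡ free
  bobReply-free s v se≡free with partner M v
  ... | nothing = se≡free
  ... | just y with s y in sy
  ...   | free = sy
  ...   | alice = se≡free
  ...   | bob = se≡free

  bobReply-partner : ∀ (s : Position n) {v y} e → v ⋈ y → s y ≡ free → bobReply s v e ≡ y
  bobReply-partner s e v⋈y sy≡free rewrite v⋈y | sy≡free = refl

  module AfterReply {s v e} (answered : BobAnswered s) (sv≡free : s v ≡ free)
                    (s₁e≡free : claim s v alice e ≡ free) where

    s₁ = claim s v alice
    w = bobReply s₁ v e

    w-free : s₁ w ≡ free
    w-free = bobReply-free s₁ v s₁e≡free

    bob-kept : ∀ {y} → s y ≡ bob → claim s₁ w bob y ≡ bob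
    bob-kept {y} sy≡bob =
      claim-keeps s₁ w bob y w-free (claim-keeps s v alice y sv≡free sy≡bob λ ()) λ ()

    bobAnswered-after-reply : BobAnswered (claim s₁ w bob)
    bobAnswered-after-reply {x} {y} x⋈y s₂x≡alice with claim-cases s₁ w bob x s₂x≡alice
    ... | inj₁ (_ , ())
    ... | inj₂ s₁x≡alice with claim-cases s v alice x s₁x≡alice
    ...   | inj₂ sx≡alice = bob-kept (answered x⋈y sx≡alice)
    ...   | inj₁ (refl , _) with s y in sy
    ...     | bob = bob-kept sy
    ...     | alice with trans (sym (answered (partner-sym M x⋈y) sy)) sv≡free
    ...       | ()
    bobAnswered-after-reply {x} {y} x⋈y _ | inj₂ _ | inj₁ (refl , _) | free =
      subst (λ z → claim s₁ z bob y ≡ bob)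
            (sym (bobReply-partner s₁ e x⋈y (trans s₁y≡sy sy))) (claim-≡ s₁ y bob)
      where
      s₁y≡sy : s₁ y ≡ s y
      s₁y≡sy = claim-≢ s x alice y λ y≡x → partner-irrefl M x⋈y (sym y≡x)

  open AfterReply using (bobAnswered-after-reply)

  bobAnswered⇒¬aliceWins : ∀ (G : SimpleGraph n) →
                           (∀ s → AliceOwnsNoPair s → ¬ Dominates G s alice) →
                           ∀ s → BobAnswered s → ¬ AliceWinsA G s
  bobAnswered⇒¬aliceWins G alice-needs-pair s answered (winNow v sv≡free dom) =
    alice-needs-pair _ (aliceOwnsNoPair-after-alice answered sv≡free) dom
  bobAnswered⇒¬aliceWins G alice-needs-pair s answered
    (moveThen v sv≡free _ (allReplies (e , s₁e≡free) _ aliceWinsAfter)) =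
    bobAnswered⇒¬aliceWins G alice-needs-pair _
      (bobAnswered-after-reply {e = e} answered sv≡free s₁e≡free)
      (aliceWinsAfter _ (bobReply-free (claim s v alice) v {e} s₁e≡free))

  pairing-strategy-draws : ∀ (G : SimpleGraph n) →
                           (∀ s → AliceOwnsNoPair s → ¬ Dominates G s alice) →
                           OutcomeD G
  pairing-strategy-draws G alice-needs-pair =
    bobAnswered⇒¬aliceWins G alice-needs-pair initial bobAnswered-initial

  cherry-centre-owned : ∀ (G : SimpleGraph n) s {c ℓ₁ ℓ₂} → AliceOwnsNoPair s →
                        Cherry G c ℓ₁ ℓ₂ → ℓ₁ ⋈ ℓ₂ → Dominates G s alice → s c ≡ alice
  cherry-centre-owned G s noPair cherry ℓ₁⋈ℓ₂ dom with dominates-cherry G cherry dom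
  ... | inj₁ sc≡alice = sc≡alice
  ... | inj₂ (sℓ₁≡alice , sℓ₂≡alice) = ⊥-elim (noPair ℓ₁⋈ℓ₂ sℓ₁≡alice sℓ₂≡alice)

  paired-cherries-draw : ∀ {G : SimpleGraph n} {c ℓ₁ ℓ₂ c′ ℓ₁′ ℓ₂′} →
                         Cherry G c ℓ₁ ℓ₂ → Cherry G c′ ℓ₁′ ℓ₂′ →
                         c ⋈ c′ → ℓ₁ ⋈ ℓ₂ → ℓ₁′ ⋈ ℓ₂′ → OutcomeD G
  paired-cherries-draw {G} cherry cherry′ c⋈c′ ℓ₁⋈ℓ₂ ℓ₁′⋈ℓ₂′ =
    pairing-strategy-draws G λ s noPair dom →
      noPair c⋈c′ (cherry-centre-owned G s noPair cherry ℓ₁⋈ℓ₂ dom)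
                  (cherry-centre-owned G s noPair cherry′ ℓ₁′⋈ℓ₂′ dom)

two-cherries-matching : ∀ {n} (F : SimpleGraph n) {c ℓ₁ ℓ₂ c′ ℓ₁′ ℓ₂′} →
                        Cherry F c ℓ₁ ℓ₂ → Cherry F c′ ℓ₁′ ℓ₂′ → c ≢ c′ →
                        Σ[ M ∈ Matching n ]
                          (Paired M c c′ × Paired M ℓ₁ ℓ₂ × Paired M ℓ₁′ ℓ₂′)
two-cherries-matching F {c} {ℓ₁} {ℓ₂} {c′} {ℓ₁′} {ℓ₂′}
  cherry@(ℓ₁≢ℓ₂ , leaf₁ , leaf₂ , c~ℓ₁ , c~ℓ₂)
  cherry′@(ℓ₁′≢ℓ₂′ , leaf₁′ , leaf₂′ , c′~ℓ₁′ , c′~ℓ₂′) c≢c′ =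
  M₃ , c⋈c′ , ℓ₁⋈ℓ₂ , ℓ₁′⋈ℓ₂′
  where
  M₁ = extend emptyMatching c≢c′ refl refl

  unmatched₁ : ∀ {ℓ} → Leaf F ℓ → Unmatched M₁ ℓ
  unmatched₁ leaf = extend-unmatched emptyMatching c≢c′ refl refl
                      (≢-sym (cherry-centre-not-leaf F cherry leaf))
                      (≢-sym (cherry-centre-not-leaf F cherry′ leaf)) refl

  ℓ₁-free₁ = unmatched₁ leaf₁
  ℓ₂-free₁ = unmatched₁ leaf₂
  M₂ = extend M₁ ℓ₁≢ℓ₂ ℓ₁-free₁ ℓ₂-free₁

  unmatched₂ : ∀ {ℓ′} → Leaf F ℓ′ → _~_ F c′ ℓ′ → Unmatched M₂ ℓ′
  unmatched₂ leaf′ c′~ℓ′ =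
    extend-unmatched M₁ ℓ₁≢ℓ₂ ℓ₁-free₁ ℓ₂-free₁
      (≢-sym (leaves-of-distinct-centres F leaf₁ c~ℓ₁ c′~ℓ′ c≢c′))
      (≢-sym (leaves-of-distinct-centres F leaf₂ c~ℓ₂ c′~ℓ′ c≢c′))
      (unmatched₁ leaf′)

  ℓ₁′-free₂ = unmatched₂ leaf₁′ c′~ℓ₁′
  ℓ₂′-free₂ = unmatched₂ leaf₂′ c′~ℓ₂′
  M₃ = extend M₂ ℓ₁′≢ℓ₂′ ℓ₁′-free₂ ℓ₂′-free₂

  keeps₃ : ∀ {x y} → Paired M₂ x y → Paired M₃ x y
  keeps₃ {x} = extendedPartner-keeps M₂ ℓ₁′≢ℓ₂′ ℓ₁′-free₂ ℓ₂′-free₂ {x}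

  c⋈c′ : Paired M₃ c c′
  c⋈c′ = keeps₃ {c} (extendedPartner-keeps M₁ ℓ₁≢ℓ₂ ℓ₁-free₁ ℓ₂-free₁ {c}
                   (extendedPartner-a emptyMatching c≢c′ refl refl))

  ℓ₁⋈ℓ₂ : Paired M₃ ℓ₁ ℓ₂
  ℓ₁⋈ℓ₂ = keeps₃ {ℓ₁} (extendedPartner-a M₁ ℓ₁≢ℓ₂ ℓ₁-free₁ ℓ₂-free₁)

  ℓ₁′⋈ℓ₂′ : Paired M₃ ℓ₁′ ℓ₂′
  ℓ₁′⋈ℓ₂′ = extendedPartner-a M₂ ℓ₁′≢ℓ₂′ ℓ₁′-free₂ ℓ₂′-free₂

lemma19 : ∀ {n : ℕ} (F : SimpleGraph n) → Forest F →
          ∀ (c ℓ₁ ℓ₂ c′ ℓ₁′ ℓ₂′ : Fin n) →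
          Cherry F c ℓ₁ ℓ₂ → Cherry F c′ ℓ₁′ ℓ₂′ → c ≢ c′ →
          OutcomeD F
lemma19 F _ c ℓ₁ ℓ₂ c′ ℓ₁′ ℓ₂′ cherry cherry′ c≢c′
  with M , c⋈c′ , ℓ₁⋈ℓ₂ , ℓ₁′⋈ℓ₂′ ← two-cherries-matching F cherry cherry′ c≢c′ =
  PairingStrategy.paired-cherries-draw M cherry cherry′ c⋈c′ ℓ₁⋈ℓ₂ ℓ₁′⋈ℓ₂′
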